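{- Let $c_1,c_2$ be constants and let $\mathbb{M}=\{M_n\}_{n\ge1}$ be a family of maximally ST-robust DAGs, where $M_n$ has $n$ inputs and $n$ outputs, $|V(M_n)|\le c_1 n$ and $\mathrm{indeg}(M_n)\le c_2$. Then for any DAG $G$ with $m$ edges, $\mathrm{Reduce}(G,\mathbb{M})$ has maximum indegree $c_2$ and at most $2c_1 m$ nodes.
   Context: For a DAG $M$ with a set $I$ of $n$ inputs and a set $O$ of $n$ outputs, $M$ is $(k_1,k_2)$-ST-robust if for every $D\subseteq V(M)$ with $|D|\le k_1$ there is a subgraph $H$ of $M-D$ with $|I\cap V(H)|\ge k_2$, $|O\cap V(H)|\ge k_2$, such that every $s\in I\cap V(H)$ has a directed path in $H$ to every $t\in O\cap V(H)$; $M$ is maximally ST-robust if it is $(k,n-k)$-ST-robust for all $0\le k\le n$. Construction $\mathrm{Reduce}(G,\mathbb{M})$ for a DAG $G=(V,E)$: let $\delta(v)=\max\{\mathrm{indeg}(v),\mathrm{outdeg}(v)\}$. The node set is $\{(v,w): v\in V, w\in V(M_{\delta(v)})\}$. Edges: $((v,u'),(v,w'))$ for every $v\in V$ and $(u',w')\in E(M_{\delta(v)})$; and, fixing for each $v$ injective maps $\pi_{in,v}$ from $\{u:(u,v)\in E\}$ to the inputs of $M_{\delta(v)}$ and $\pi_{out,v}$ from $\{u:(v,u)\in E\}$ to the outputs of $M_{\delta(v)}$, the edge $((u,\pi_{out,u}(v)),(v,\pi_{in,v}(u)))$ for every $(u,v)\in E$. -}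

module Defs where

open import Data.Nat using (ℕ; zero; suc; _+_; _*_; _∸_; _≤_; _⊔_)
open import Data.Bool using (Bool; true; false; if_then_else_; _∨_; _∧_; T; T?)
open import Data.Fin using (Fin; zero; suc; _≟_)
open import Data.Product using (Σ; _,_; _×_; ∃)
open import Relation.Nullary using (¬_; yes; no)
open import Relation.Nullary.Decidable using (⌊_⌋)
open import Relation.Binary.PropositionalEquality using (_≡_; refl)
open import Relation.Binary.Construct.Closure.ReflexiveTransitive using (Star)

sumF : (n : ℕ) → (Fin n → ℕ) → ℕ
sumF zero    f = 0
sumF (suc n) f = f zero + sumF n (λ i → f (suc i))

countF : (n : ℕ) → (Fin n → Bool) → ℕ
countF n p = sumF n (λ i → if p i then 1 else 0)

record Graph : Set where
  field
    N : ℕ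
    E : Fin N → Fin N → Bool
open Graph public

Edge : (G : Graph) → Fin (N G) → Fin (N G) → Set
Edge G u v = T (E G u v)

Path : (G : Graph) → Fin (N G) → Fin (N G) → Set
Path G = Star (Edge G)

Acyclic : Graph → Set
Acyclic G = ∀ u v → Edge G u v → ¬ Path G v u

indeg : (G : Graph) → Fin (N G) → ℕ
indeg G v = countF (N G) (λ u → E G u v)

outdeg : (G : Graph) → Fin (N G) → ℕ
outdeg G u = countF (N G) (λ v → E G u v)

edges : Graph → ℕ
edges G = sumF (N G) (λ u → outdeg G u)

MaxIndegAtMost : Graph → ℕ → Set
MaxIndegAtMost G c = ∀ v → indeg G v ≤ c

-- DAGs with n (distinct) inputs and n (distinct) outputs.
-- Inputs are sources (indegree 0), as is standard for the input nodes.

record IODAG (n : ℕ) : Set where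
  field
    graph      : Graph
    acyclic    : Acyclic graph
    inp        : Fin n → Fin (N graph)
    out        : Fin n → Fin (N graph)
    inp-inj    : ∀ i j → inp i ≡ inp j → i ≡ j
    out-inj    : ∀ i j → out i ≡ out j → i ≡ j
    inp-source : ∀ i u → E graph u (inp i) ≡ false
open IODAG public

size : ∀ {n} → IODAG n → ℕ
size M = N (graph M)

record Subgraph (G : Graph) : Set where
  field
    hV      : Fin (N G) → Bool
    hE      : Fin (N G) → Fin (N G) → Bool
    hE⊆E    : ∀ u v → T (hE u v) → T (E G u v)
    hE-src  : ∀ u v → T (hE u v) → T (hV u)
    hE-tgt  : ∀ u v → T (hE u v) → T (hV v)
open Subgraph public

HPath : ∀ {G} → Subgraph G → Fin (N G) → Fin (N G) → Set
HPath H = Star (λ u v → T (hE H u v))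

STRobust : ∀ {n} → IODAG n → ℕ → ℕ → Set
STRobust {n} M k₁ k₂ =
  (D : Fin (size M) → Bool) → countF (size M) D ≤ k₁ →
  Σ (Subgraph (graph M)) λ H →
    (∀ x → T (hV H x) → ¬ T (D x)) ×
    k₂ ≤ countF n (λ i → hV H (inp M i)) ×
    k₂ ≤ countF n (λ j → hV H (out M j)) ×
    (∀ i j → T (hV H (inp M i)) → T (hV H (out M j)) →
       HPath H (inp M i) (out M j))

MaximallySTRobust : ∀ {n} → IODAG n → Set
MaximallySTRobust {n} M = ∀ k → k ≤ n → STRobust M k (n ∸ k)

-- A family 𝕄 = {M_n}_{n ≥ 1}: Fam k is M_{k+1}.

Family : Set
Family = (k : ℕ) → IODAG (suc k)

emptyIO : IODAG 0
emptyIO = record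
  { graph = record { N = 0 ; E = λ () }
  ; acyclic = λ ()
  ; inp = λ () ; out = λ ()
  ; inp-inj = λ () ; out-inj = λ ()
  ; inp-source = λ () }

-- M_n for every n, with the convention M_0 = empty DAG
-- (used only for isolated vertices v of G, i.e. δ(v) = 0)
famAt : Family → (n : ℕ) → IODAG n
famAt 𝕄 zero    = emptyIO
famAt 𝕄 (suc k) = 𝕄 k

δ : (G : Graph) → Fin (N G) → ℕ
δ G v = indeg G v ⊔ outdeg G v

record PortMaps (G : Graph) : Set where
  field
    πin     : (v u : Fin (N G)) → Edge G u v → Fin (δ G v)
    πout    : (u v : Fin (N G)) → Edge G u v → Fin (δ G u)
    πin-inj : ∀ v u u' (p : Edge G u v) (p' : Edge G u' v) →
                πin v u p ≡ πin v u' p' → u ≡ u'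
    πout-inj : ∀ u v v' (p : Edge G u v) (p' : Edge G u v') →
                πout u v p ≡ πout u v' p' → v ≡ v'
open PortMaps public

module Reduce (G : Graph) (𝕄 : Family) (π : PortMaps G) where

  Mv : (v : Fin (N G)) → IODAG (δ G v)
  Mv v = famAt 𝕄 (δ G v)

  RNode : Set
  RNode = Σ (Fin (N G)) λ v → Fin (size (Mv v))

  internal : (u : Fin (N G)) (a : Fin (size (Mv u)))
             (v : Fin (N G)) (b : Fin (size (Mv v))) → Bool
  internal u a v b with u ≟ v
  ... | yes refl = E (graph (Mv u)) a b
  ... | no _     = false

  cross : (u : Fin (N G)) (a : Fin (size (Mv u)))
          (v : Fin (N G)) (b : Fin (size (Mv v))) → Bool
  cross u a v b with T? (E G u v)
  ... | yes p = ⌊ a ≟ out (Mv u) (πout π u v p) ⌋ ∧ ⌊ b ≟ inp (Mv v) (πin π v u p) ⌋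
  ... | no _  = false

  RE : RNode → RNode → Bool
  RE (u , a) (v , b) = internal u a v b ∨ cross u a v b

  nodeCount : ℕ
  nodeCount = sumF (N G) (λ v → size (Mv v))

  rindeg : RNode → ℕ
  rindeg x = sumF (N G) (λ v → countF (size (Mv v)) (λ w → RE (v , w) x))

-- Reduce(G , 𝕄) replaces every vertex v of G by a gadget M_δ(v). A node of a gadget that is not
-- an input port keeps its in-edges from M_δ(v), at most c₂ of them. An input port is a source of its
-- gadget and, πin being injective, receives only the one cross edge assigned to it, so indegree 1;
-- this is within c₂ because a maximally ST-robust M₂ must have an edge. The gadget at v has at most
-- c₁ δ(v) ≤ c₁ (indeg v + outdeg v) nodes, and summing over v counts every edge of G twice.
module Submission where

open import Defs
open import Data.Nat using (ℕ; zero; suc; _+_; _*_; _≤_; z≤n; s≤s; _≤?_)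
open import Data.Nat.Properties
  using (≤-refl; ≤-trans; ≤-reflexive; +-mono-≤; *-monoʳ-≤; m≤n+m; m⊔n≤m+n;
         +-identityʳ; *-assoc; *-comm; ≰⇒>; n<1⇒n≡0; 1+n≰n; +-*-semiring;
         module ≤-Reasoning)
open import Data.Bool using (Bool; true; false; if_then_else_; T; T?)
open import Data.Bool.Properties using (T-irrelevant)
open import Data.Fin using (Fin; zero; suc; _≟_)
open import Data.Fin.Properties using (any?; suc-injective)
open import Data.Product using (Σ; _,_; _×_; ∃)
open import Data.Sum using (_⊎_; inj₁; inj₂; [_,_]′)
open import Data.Empty using (⊥-elim)
open import Data.Unit using (tt)
open import Function using (_∘_)
open import Relation.Nullary using (¬_; yes; no)
open import Relation.Binary.PropositionalEquality
  using (_≡_; _≢_; refl; sym; trans; cong; cong₂; subst)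
open import Relation.Binary.Construct.Closure.ReflexiveTransitive using (ε; _◅_)
open import Algebra.Properties.Semiring.Sum +-*-semiring
  using (sum; sum-cong-≗; ∑-distrib-+; ∑-comm; *-distribˡ-sum; *-distribʳ-sum)

sumF≡sum : ∀ n (f : Fin n → ℕ) → sumF n f ≡ sum f
sumF≡sum zero    f = refl
sumF≡sum (suc n) f = cong (f zero +_) (sumF≡sum n (f ∘ suc))

sumF-*ʳ : ∀ n (f : Fin n → ℕ) c → sumF n f * c ≡ sumF n (λ i → f i * c)
sumF-*ʳ n f c = trans (cong (_* c) (sumF≡sum n f))
                  (trans (*-distribʳ-sum c f) (sym (sumF≡sum n (λ i → f i * c))))

sumF-*ˡ : ∀ n c (f : Fin n → ℕ) → c * sumF n f ≡ sumF n (λ i → c * f i)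
sumF-*ˡ n c f = trans (cong (c *_) (sumF≡sum n f))
                  (trans (*-distribˡ-sum c f) (sym (sumF≡sum n (λ i → c * f i))))

sumF-+ : ∀ n (f g : Fin n → ℕ) → sumF n (λ i → f i + g i) ≡ sumF n f + sumF n g
sumF-+ n f g = trans (sumF≡sum n (λ i → f i + g i))
                 (trans (∑-distrib-+ f g) (sym (cong₂ _+_ (sumF≡sum n f) (sumF≡sum n g))))

sumF-comm : ∀ m n (g : Fin m → Fin n → ℕ) →
            sumF m (λ i → sumF n (g i)) ≡ sumF n (λ j → sumF m (λ i → g i j))
sumF-comm m n g = trans (sumF²≡sum² m n g) (trans (∑-comm g) (sym (sumF²≡sum² n m λ j i → g i j)))
  where
  sumF²≡sum² : ∀ m n (g : Fin m → Fin n → ℕ) →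
               sumF m (λ i → sumF n (g i)) ≡ sum (λ i → sum (g i))
  sumF²≡sum² m n g = trans (sumF≡sum m _) (sum-cong-≗ λ i → sumF≡sum n (g i))

sumF-mono : ∀ n {f g : Fin n → ℕ} → (∀ i → f i ≤ g i) → sumF n f ≤ sumF n g
sumF-mono zero    f≤g = z≤n
sumF-mono (suc n) f≤g = +-mono-≤ (f≤g zero) (sumF-mono n (f≤g ∘ suc))

sumF-zero : ∀ n {f : Fin n → ℕ} → (∀ i → f i ≡ 0) → sumF n f ≡ 0
sumF-zero zero    f≡0 = refl
sumF-zero (suc n) f≡0 rewrite f≡0 zero = sumF-zero n (f≡0 ∘ suc)

sumF-single : ∀ n (f : Fin n → ℕ) k → (∀ i → i ≢ k → f i ≡ 0) → sumF n f ≡ f k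
sumF-single (suc n) f zero f≡0 =
  trans (cong (f zero +_) (sumF-zero n (λ i → f≡0 (suc i) λ ()))) (+-identityʳ (f zero))
sumF-single (suc n) f (suc k) f≡0 rewrite f≡0 zero (λ ()) =
  sumF-single n (f ∘ suc) k (λ i i≢k → f≡0 (suc i) (i≢k ∘ suc-injective))

sumF≤1 : ∀ n (f : Fin n → ℕ) → (∀ i → f i ≤ 1) →
         (∀ i j → 1 ≤ f i → 1 ≤ f j → i ≡ j) → sumF n f ≤ 1
sumF≤1 zero    f f≤1 unique = z≤n
sumF≤1 (suc n) f f≤1 unique with 1 ≤? f zero
... | yes f₀>0 = subst (λ s → f zero + s ≤ 1) (sym rest≡0)
                   (subst (_≤ 1) (sym (+-identityʳ (f zero))) (f≤1 zero))
  where
  rest≡0 : sumF n (f ∘ suc) ≡ 0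
  rest≡0 = sumF-zero n λ i → n<1⇒n≡0 (≰⇒> λ fᵢ>0 → 0≢suc (unique zero (suc i) f₀>0 fᵢ>0))
    where
    0≢suc : ∀ {i : Fin n} → Fin.zero ≢ suc i
    0≢suc ()
... | no f₀≯0 rewrite n<1⇒n≡0 (≰⇒> f₀≯0) =
  sumF≤1 n (f ∘ suc) (f≤1 ∘ suc)
    (λ i j fᵢ>0 fⱼ>0 → suc-injective (unique (suc i) (suc j) fᵢ>0 fⱼ>0))

T⇒count-pos : ∀ n (p : Fin n → Bool) i → T (p i) → 1 ≤ countF n p
T⇒count-pos (suc n) p zero t with p zero
... | true  = s≤s z≤n
... | false = ⊥-elim t
T⇒count-pos (suc n) p (suc i) t = ≤-trans (T⇒count-pos n (p ∘ suc) i t) (m≤n+m _ _)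

count-pos⇒T : ∀ n (p : Fin n → Bool) → 1 ≤ countF n p → ∃ λ i → T (p i)
count-pos⇒T (suc n) p pos with p zero in eq
... | true  = zero , subst T (sym eq) tt
... | false with count-pos⇒T n (p ∘ suc) pos
...   | i , t = suc i , t

count-none : ∀ n (p : Fin n → Bool) → (∀ i → ¬ T (p i)) → countF n p ≡ 0
count-none n p none = sumF-zero n λ i → ind≡0 (p i) (none i)
  where
  ind≡0 : ∀ b → ¬ T b → (if b then 1 else 0) ≡ 0
  ind≡0 true  ¬b = ⊥-elim (¬b tt)
  ind≡0 false ¬b = refl

count-mono : ∀ n {p q : Fin n → Bool} → (∀ i → T (p i) → T (q i)) → countF n p ≤ countF n q
count-mono n p⇒q = sumF-mono n λ i → ind-mono _ _ (p⇒q i)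
  where
  ind-mono : ∀ b c → (T b → T c) → (if b then 1 else 0) ≤ (if c then 1 else 0)
  ind-mono true  true  _   = ≤-refl
  ind-mono true  false b⇒c = ⊥-elim (b⇒c tt)
  ind-mono false c     _   = z≤n

count≤1 : ∀ n (p : Fin n → Bool) → (∀ i j → T (p i) → T (p j) → i ≡ j) → countF n p ≤ 1
count≤1 n p unique = sumF≤1 n _ (λ i → ind≤1 (p i))
  (λ i j pᵢ pⱼ → unique i j (ind-pos⇒T (p i) pᵢ) (ind-pos⇒T (p j) pⱼ))
  where
  ind≤1 : ∀ b → (if b then 1 else 0) ≤ 1
  ind≤1 true  = ≤-refl
  ind≤1 false = z≤n
  ind-pos⇒T : ∀ b → 1 ≤ (if b then 1 else 0) → T b
  ind-pos⇒T true _ = tt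

indeg≤0⇒no-edge : ∀ G → MaxIndegAtMost G 0 → ∀ u v → ¬ Edge G u v
indeg≤0⇒no-edge G indeg≤0 u v e =
  1+n≰n (≤-trans (T⇒count-pos (N G) (λ w → E G w v) u e) (indeg≤0 v))

sum-indeg≡edges : ∀ G → sumF (N G) (indeg G) ≡ edges G
sum-indeg≡edges G = sumF-comm (N G) (N G) λ v u → if E G u v then 1 else 0

sum-δ≤2*edges : ∀ G → sumF (N G) (δ G) ≤ 2 * edges G
sum-δ≤2*edges G = begin
  sumF (N G) (δ G)                           ≤⟨ sumF-mono (N G) (λ v → m⊔n≤m+n (indeg G v) (outdeg G v)) ⟩
  sumF (N G) (λ v → indeg G v + outdeg G v)  ≡⟨ sumF-+ (N G) (indeg G) (outdeg G) ⟩
  sumF (N G) (indeg G) + edges G             ≡⟨ cong (_+ edges G) (sum-indeg≡edges G) ⟩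
  edges G + edges G                          ≡⟨ cong (edges G +_) (+-identityʳ (edges G)) ⟨
  2 * edges G                                ∎
  where open ≤-Reasoning

robust⇒has-edge : ∀ {n} (M : IODAG n) → STRobust M 0 2 → ¬ (∀ u v → ¬ Edge (graph M) u v)
robust⇒has-edge {n} M robust no-edge
  with robust (λ _ → false) (≤-reflexive (count-none (size M) _ λ _ ()))
... | H , _ , two-inputs , two-outputs , path = 1+n≰n (≤-trans two-inputs inputs≤1)
  where
  path-trivial : ∀ {x y} → HPath H x y → x ≡ y
  path-trivial ε       = refl
  path-trivial (e ◅ _) = ⊥-elim (no-edge _ _ (hE⊆E H _ _ e))
  some-output : ∃ λ j → T (hV H (out M j))
  some-output = count-pos⇒T n _ (≤-trans (s≤s z≤n) two-outputs)
  inputs≤1 : countF n (λ i → hV H (inp M i)) ≤ 1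
  inputs≤1 = count≤1 n _ λ i i' hᵢ hᵢ' →
    let (j , hⱼ) = some-output in
    inp-inj M i i' (trans (path-trivial (path i j hᵢ hⱼ)) (sym (path-trivial (path i' j hᵢ' hⱼ))))

robust⇒indeg-pos : ∀ {n} (M : IODAG n) → STRobust M 0 2 →
                   ∀ {c} → MaxIndegAtMost (graph M) c → 1 ≤ c
robust⇒indeg-pos M robust {zero}  indeg≤0 =
  ⊥-elim (robust⇒has-edge M robust (indeg≤0⇒no-edge (graph M) indeg≤0))
robust⇒indeg-pos M robust {suc c} _       = s≤s z≤n

module ReduceBounds (G : Graph) (𝕄 : Family) (π : PortMaps G) where
  open Reduce G 𝕄 π

  RE⇒internal⊎cross : ∀ {u a v b} → T (RE (u , a) (v , b)) → T (internal u a v b) ⊎ T (cross u a v b)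
  RE⇒internal⊎cross {u} {a} {v} {b} t with internal u a v b
  ... | true  = inj₁ tt
  ... | false = inj₂ t

  internal⇒≡ : ∀ {u a v b} → T (internal u a v b) → u ≡ v
  internal⇒≡ {u} {a} {v} {b} t with u ≟ v
  ... | yes u≡v = u≡v
  ... | no  _   = ⊥-elim t

  internal-diag : ∀ v a b → internal v a v b ≡ E (graph (Mv v)) a b
  internal-diag v a b with v ≟ v
  ... | yes refl = refl
  ... | no  v≢v  = ⊥-elim (v≢v refl)

  internal-into-input : ∀ u a v i → internal u a v (inp (Mv v) i) ≡ false
  internal-into-input u a v i with u ≟ v
  ... | yes refl = inp-source (Mv u) i a
  ... | no  _    = refl

  cross⇒port-edge : ∀ {u a v b} → T (cross u a v b) →
    Σ (Edge G u v) λ e → a ≡ out (Mv u) (πout π u v e) × b ≡ inp (Mv v) (πin π v u e)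
  cross⇒port-edge {u} {a} {v} {b} t with T? (E G u v)
  ... | no  _ = ⊥-elim t
  ... | yes e with a ≟ out (Mv u) (πout π u v e) | b ≟ inp (Mv v) (πin π v u e)
  ...   | yes a≡ | yes b≡ = e , a≡ , b≡
  ...   | yes _  | no  _  = ⊥-elim t
  ...   | no  _  | _      = ⊥-elim t

  RE-into-input : ∀ {u a v i} → T (RE (u , a) (v , inp (Mv v) i)) →
    Σ (Edge G u v) λ e → a ≡ out (Mv u) (πout π u v e) × i ≡ πin π v u e
  RE-into-input {u} {a} {v} {i} t with RE⇒internal⊎cross t
  ... | inj₁ tᵢ = ⊥-elim (subst T (internal-into-input u a v i) tᵢ)
  ... | inj₂ tₓ with cross⇒port-edge tₓ
  ...   | e , a≡ , inpᵢ≡ = e , a≡ , inp-inj (Mv v) _ _ inpᵢ≡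

  rindeg-input : ∀ v i → rindeg (v , inp (Mv v) i) ≤ 1
  rindeg-input v i = sumF≤1 (N G) _ from-one-node from-one-gadget
    where
    into : ∀ u → Fin (size (Mv u)) → Bool
    into u a = RE (u , a) (v , inp (Mv v) i)
    from-one-node : ∀ u → countF (size (Mv u)) (into u) ≤ 1
    from-one-node u = count≤1 _ (into u) λ a a' t t' →
      let (e , a≡ , _) = RE-into-input t
          (e' , a'≡ , _) = RE-into-input t'
      in trans a≡ (trans (cong (out (Mv u) ∘ πout π u v) (T-irrelevant e e')) (sym a'≡))
    from-one-gadget : ∀ u u' → 1 ≤ countF (size (Mv u)) (into u) →
                      1 ≤ countF (size (Mv u')) (into u') → u ≡ u'
    from-one-gadget u u' pos pos' =
      let (_ , t) = count-pos⇒T _ (into u) pos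
          (_ , t') = count-pos⇒T _ (into u') pos'
          (e , _ , i≡) = RE-into-input t
          (e' , _ , i≡') = RE-into-input t'
      in πin-inj π v u u' e e' (trans (sym i≡) i≡')

  rindeg-non-input : ∀ v b → (∀ i → inp (Mv v) i ≢ b) → rindeg (v , b) ≤ indeg (graph (Mv v)) b
  rindeg-non-input v b non-input = begin
    rindeg (v , b)                                   ≡⟨ sumF-single (N G) _ v only-from-own-gadget ⟩
    countF (size (Mv v)) (λ a → RE (v , a) (v , b))  ≤⟨ count-mono _ {q = λ a → E (graph (Mv v)) a b}
                                                          (λ a t → internal-edge (RE⇒internal⊎cross t)) ⟩
    indeg (graph (Mv v)) b                           ∎
    where
    open ≤-Reasoning
    no-cross : ∀ {u a} → ¬ T (cross u a v b)
    no-cross t = let (_ , _ , b≡) = cross⇒port-edge t in non-input _ (sym b≡)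
    only-from-own-gadget : ∀ u → u ≢ v → countF (size (Mv u)) (λ a → RE (u , a) (v , b)) ≡ 0
    only-from-own-gadget u u≢v = count-none _ (λ a → RE (u , a) (v , b)) λ a t →
      [ u≢v ∘ internal⇒≡ , no-cross ]′ (RE⇒internal⊎cross t)
    internal-edge : ∀ {a} → T (internal v a v b) ⊎ T (cross v a v b) → T (E (graph (Mv v)) a b)
    internal-edge {a} (inj₁ tᵢ) = subst T (internal-diag v a b) tᵢ
    internal-edge     (inj₂ tₓ) = ⊥-elim (no-cross tₓ)

  rindeg≤ : ∀ {c} → 1 ≤ c → (∀ v → MaxIndegAtMost (graph (Mv v)) c) → ∀ x → rindeg x ≤ c
  rindeg≤ 1≤c indeg≤c (v , b) with any? (λ i → inp (Mv v) i ≟ b)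
  ... | yes (i , refl) = ≤-trans (rindeg-input v i) 1≤c
  ... | no  non-input  = ≤-trans (rindeg-non-input v b λ i eq → non-input (i , eq)) (indeg≤c v b)

  nodeCount≤ : ∀ {a d} → (∀ v → size (Mv v) * d ≤ a * δ G v) → nodeCount * d ≤ 2 * a * edges G
  nodeCount≤ {a} {d} size≤ = begin
    nodeCount * d                          ≡⟨ sumF-*ʳ (N G) _ d ⟩
    sumF (N G) (λ v → size (Mv v) * d)     ≤⟨ sumF-mono (N G) size≤ ⟩
    sumF (N G) (λ v → a * δ G v)           ≡⟨ sumF-*ˡ (N G) a (δ G) ⟨
    a * sumF (N G) (δ G)                   ≤⟨ *-monoʳ-≤ a (sum-δ≤2*edges G) ⟩
    a * (2 * edges G)                      ≡⟨ *-assoc a 2 (edges G) ⟨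
    a * 2 * edges G                        ≡⟨ cong (_* edges G) (*-comm a 2) ⟩
    2 * a * edges G                        ∎
    where open ≤-Reasoning

famAt-indeg≤ : ∀ (𝕄 : Family) {c} → (∀ k → MaxIndegAtMost (graph (𝕄 k)) c) →
               ∀ n → MaxIndegAtMost (graph (famAt 𝕄 n)) c
famAt-indeg≤ 𝕄 indeg≤ zero    ()
famAt-indeg≤ 𝕄 indeg≤ (suc k) = indeg≤ k

famAt-size≤ : ∀ (𝕄 : Family) {a d} → (∀ k → size (𝕄 k) * d ≤ a * suc k) →
              ∀ n → size (famAt 𝕄 n) * d ≤ a * n
famAt-size≤ 𝕄 size≤ zero    = z≤n
famAt-size≤ 𝕄 size≤ (suc k) = size≤ k

corollary1 : (c₁num c₁den c₂ : ℕ) (𝕄 : Family) →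
    (∀ k → MaximallySTRobust (𝕄 k)) →
    (∀ k → size (𝕄 k) * c₁den ≤ c₁num * suc k) →
    (∀ k → MaxIndegAtMost (graph (𝕄 k)) c₂) →
    (G : Graph) → Acyclic G → (π : PortMaps G) →
    (∀ x → Reduce.rindeg G 𝕄 π x ≤ c₂) ×
    (Reduce.nodeCount G 𝕄 π * c₁den ≤ 2 * c₁num * edges G)
corollary1 c₁num c₁den c₂ 𝕄 robust size≤ indeg≤ G _ π =
  rindeg≤ 1≤c₂ (λ v → famAt-indeg≤ 𝕄 indeg≤ (δ G v)) ,
  nodeCount≤ {a = c₁num} (λ v → famAt-size≤ 𝕄 {a = c₁num} size≤ (δ G v))
  where
  open ReduceBounds G 𝕄 π
  1≤c₂ : 1 ≤ c₂
  1≤c₂ = robust⇒indeg-pos (𝕄 1) (robust 1 0 z≤n) (indeg≤ 1)
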